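{- Let $Q$ be a quasi-order. For every bad locally constant map $h:[\omega]^{\omega}\to V^{*}(Q)$ there exists a bad locally constant map $g:[\omega]^{\omega}\to Q$ such that moreover $g(X)\in\mathrm{supp}(h(X))$ for every $X\in[\omega]^{\omega}$.
   Context: $V^{*}(Q)=\bigcup_{\alpha}V^{*}_{\alpha}(Q)$ where $V^{*}_{0}(Q)=Q$ (elements of $Q$ treated as urelements), $V^{*}_{\alpha+1}(Q)$ is the set of non-empty subsets of $V^{*}_{\alpha}(Q)$, and $V^{*}_{\lambda}(Q)=\bigcup_{\alpha<\lambda}V^{*}_{\alpha}(Q)$ for limit $\lambda$. $\mathrm{supp}(q)=\{q\}$ for $q\in Q$, and $\mathrm{supp}(X)=\bigcup_{x\in X}\mathrm{supp}(x)$ otherwise. $V^{*}(Q)$ is quasi-ordered by: $X\leq Y$ iff Player II has a winning strategy in the game $G(X,Y)$, where Player I plays $X'\in X$ if $X\notin Q$ and $X'=X$ otherwise, then Player II plays $Y'\in Y$ if $Y\notin Q$ and $Y'=Y$ otherwise; if $X',Y'\in Q$ Player II wins iff $X'\leq_{Q}Y'$, otherwise play continues as in $G(X',Y')$. Equivalently, by induction: for $X,Y\in Q$, $X\leq Y$ iff $X\leq_{Q}Y$; for $X\in Q$, $Y\notin Q$: iff some $Y'\in Y$ has $X\leq Y'$; for $X\notin Q$, $Y\in Q$: iff every $X'\in X$ has $X'\leq Y$; for $X,Y\notin Q$: iff every $X'\in X$ has some $Y'\in Y$ with $X'\leq Y'$. $[\omega]^{\omega}$ is the set of infinite subsets of $\omega$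 with the Cantor-space topology; a map $h$ from $[\omega]^{\omega}$ into a set is locally constant if for every $Y$ there is a finite proper initial segment $s$ of $Y$ such that $h$ is constant on all $Z\in[\omega]^{\omega}$ having $s$ as a proper initial segment. A map $h$ from $[\omega]^{\omega}$ into a quasi-order is bad if $h(N)\not\leq h(N\setminus\{\min N\})$ for every $N$. -}

module Defs where

open import Level using (Level)
open import Data.Nat using (ℕ; suc; _<_)
open import Data.Product using (Σ; _×_)
open import Data.Empty using (⊥)
open import Relation.Nullary using (¬_)
open import Relation.Binary.PropositionalEquality using (_≡_)

-- V*(Q): hereditarily non-empty well-founded sets over the urelements A.
-- A set is given by a non-empty index type I (witnessed by an element)
-- together with an I-indexed family of its elements (Aczel-style W-type).
-- Sets are compared extensionally (_≈*_ below), never with _≡_.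

data V* (A : Set) : Set₁ where
  ur   : A → V* A
  node : (I : Set) → I → (I → V* A) → V* A

_≈*_ : {A : Set} → V* A → V* A → Set
ur p ≈* ur q = p ≡ q
ur p ≈* node I _ f = ⊥
node I _ f ≈* ur q = ⊥
node I _ f ≈* node J _ g =
  (∀ i → Σ J λ j → f i ≈* g j) × (∀ j → Σ I λ i → f i ≈* g j)

-- The quasi-order on V*(Q) (inductive description of the game order).
module _ {A : Set} (_≲_ : A → A → Set) where
  _≤*_ : V* A → V* A → Set
  ur p ≤* ur q = p ≲ q
  ur p ≤* node J _ g = Σ J λ j → ur p ≤* g j
  node I _ f ≤* ur q = ∀ i → f i ≤* ur q
  node I _ f ≤* node J _ g = ∀ i → Σ J λ j → f i ≤* g j

_∈supp_ : {A : Set} → A → V* A → Set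
q ∈supp ur p = q ≡ p
q ∈supp node I _ f = Σ I λ i → q ∈supp f i

-- [ω]^ω: an infinite subset of ω, given by its strictly increasing
-- enumeration.

record Inf : Set where
  field
    seq  : ℕ → ℕ
    incr : ∀ i → seq i < seq (suc i)
open Inf public

drop-min : Inf → Inf
seq (drop-min N) i = seq N (suc i)
incr (drop-min N) i = incr N (suc i)

Extends : Inf → ℕ → Inf → Set
Extends Y n Z = ∀ i → i < n → seq Z i ≡ seq Y i

-- Locally constant, with respect to the equality _~_ on the codomain:
-- every Y has a finite proper initial segment s (its first n elements)
-- such that h is constant on all Z having s as proper initial segment.
LocallyConstant : {b : Level} {B : Set b} → (B → B → Set) → (Inf → B) → Set
LocallyConstant _~_ h =
  ∀ Y → Σ ℕ λ n → ∀ Z Z′ → Extends Y n Z → Extends Y n Z′ → h Z ~ h Z′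

Bad : {b : Level} {B : Set b} → (B → B → Set) → (Inf → B) → Set
Bad _≤_ h = ∀ N → ¬ (h N ≤ h (drop-min N))

-- Choose in every value h(N) an element witnessing h(N) ≰ h(N ∖ {min N}):
-- one that is not below h(N ∖ {min N}) if the latter is an urelement, and
-- not below any of its elements otherwise; urelements are kept. The resulting
-- map N ↦ h′(N) ∈ h(N) is again bad. Iterating, the values at each N descend
-- along ∈, so by well-foundedness of V*(Q) they reach an urelement g(N) after
-- finitely many steps and stay there; g is bad and, like every iterate,
-- locally constant.
-- Choices made by excluded middle respect _≡_ but not extensional equality,
-- so h is first replaced by an ≡-locally constant map: evaluate it at a
-- canonical completion of the shortest initial segment on which it is constant.

module Submission where

open import Defs
open import Level using (0ℓ; lift; lower) renaming (suc to lsuc)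
open import Function using (_∘_)
open import Data.Bool using (Bool; true; false; if_then_else_)
open import Data.Bool.Properties using (not-¬)
open import Data.Nat using (ℕ; zero; suc; _<_; _≤_; _⊔_; z≤n; s≤s; _≤′_; ≤′-reflexive; ≤′-step)
open import Data.Nat.Properties
  using (≤-refl; ≤-trans; ≤-antisym; <⇒≤; ≮⇒≥; n≤1+n; m≤m⊔n; m≤n⊔m; m≤n⇒m⊔n≡n; ≤⇒≤′)
open import Data.List using (List; []; _∷_; applyUpTo)
open import Data.Product using (Σ; _×_; _,_; proj₁; proj₂)
open import Data.Empty using (⊥-elim)
open import Relation.Nullary using (¬_; Dec; yes; no; does)
open import Relation.Nullary.Decidable using (dec-true; map′)
open import Relation.Binary.PropositionalEquality
  using (_≡_; refl; sym; trans; cong; cong₂; subst; subst₂)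
open import Relation.Binary.Structures using (IsPreorder)
open import Axiom.ExcludedMiddle using (ExcludedMiddle)
open import Axiom.DoubleNegationElimination using (em⇒dne)

lower-em : ∀ {ℓ} → ExcludedMiddle (lsuc ℓ) → ExcludedMiddle ℓ
lower-em em = map′ lower lift em

does-true⇒ : ∀ {a} {P : Set a} (P? : Dec P) → does P? ≡ true → P
does-true⇒ (yes p) _ = p

-- least D N is the least m ≤ N with D m ≡ true (and N if there is none).
least : (ℕ → Bool) → ℕ → ℕ
least D zero = zero
least D (suc N) = if D 0 then 0 else suc (least (D ∘ suc) N)

least-true : ∀ (D : ℕ → Bool) N → D N ≡ true → D (least D N) ≡ true
least-true D zero DN = DN
least-true D (suc N) DN with D 0 in D0
... | true = D0
... | false = least-true (D ∘ suc) N DN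

least-minimal : ∀ (D : ℕ → Bool) N m → m < least D N → D m ≡ false
least-minimal D (suc N) m m< with D 0 in D0
least-minimal D (suc N) zero m< | false = D0
least-minimal D (suc N) (suc m) (s≤s m<) | false = least-minimal (D ∘ suc) N m m<

least-unique : ∀ (D : ℕ → Bool) n N → D n ≡ true → (∀ m → m < n → D m ≡ false) →
  D N ≡ true → least D N ≡ n
least-unique D n N Dn below DN = ≤-antisym
  (≮⇒≥ λ n<l → not-¬ Dn (least-minimal D N n n<l))
  (≮⇒≥ λ l<n → not-¬ (least-true D N DN) (below _ l<n))

applyUpTo-cong< : ∀ {a} {A : Set a} {f g : ℕ → A} n →
  (∀ i → i < n → f i ≡ g i) → applyUpTo f n ≡ applyUpTo g n
applyUpTo-cong< zero f≡g = refl
applyUpTo-cong< (suc n) f≡g =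
  cong₂ _∷_ (f≡g 0 (s≤s z≤n)) (applyUpTo-cong< n (λ i i<n → f≡g (suc i) (s≤s i<n)))

-- Past the end of the list, nth returns 0.
nth : List ℕ → ℕ → ℕ
nth [] i = 0
nth (x ∷ xs) zero = x
nth (x ∷ xs) (suc i) = nth xs i

nth-applyUpTo : ∀ (f : ℕ → ℕ) n i → i < n → nth (applyUpTo f n) i ≡ f i
nth-applyUpTo f (suc n) zero i<n = refl
nth-applyUpTo f (suc n) (suc i) (s≤s i<n) = nth-applyUpTo (f ∘ suc) n i i<n

prefix : Inf → ℕ → List ℕ
prefix Z n = applyUpTo (seq Z) n

complete : List ℕ → Inf
seq (complete l) zero = nth l 0
seq (complete l) (suc i) = suc (seq (complete l) i) ⊔ nth l (suc i)
incr (complete l) i = m≤m⊔n _ (nth l (suc i))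

module _ {Y Z : Inf} {n : ℕ} where

  Extends-sym : Extends Y n Z → Extends Z n Y
  Extends-sym Z⊒Y i i<n = sym (Z⊒Y i i<n)

  Extends-trans : ∀ {W} → Extends Y n Z → Extends Z n W → Extends Y n W
  Extends-trans Z⊒Y W⊒Z i i<n = trans (W⊒Z i i<n) (Z⊒Y i i<n)

  Extends-≤ : ∀ {m} → m ≤ n → Extends Y n Z → Extends Y m Z
  Extends-≤ m≤n Z⊒Y i i<m = Z⊒Y i (≤-trans i<m m≤n)

  prefix-cong : Extends Y n Z → prefix Z n ≡ prefix Y n
  prefix-cong = applyUpTo-cong< n

Extends-refl : ∀ {Y n} → Extends Y n Y
Extends-refl i i<n = refl

Extends-drop-min : ∀ {Y Z n} → Extends Y (suc n) Z → Extends (drop-min Y) n (drop-min Z)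
Extends-drop-min Z⊒Y i i<n = Z⊒Y (suc i) (s≤s i<n)

Extends-complete-prefix : ∀ Z n → Extends Z n (complete (prefix Z n))
Extends-complete-prefix Z n zero i<n = nth-applyUpTo (seq Z) n 0 i<n
Extends-complete-prefix Z n (suc i) i<n
  rewrite Extends-complete-prefix Z n i (≤-trans (n≤1+n (suc i)) i<n)
        | nth-applyUpTo (seq Z) n (suc i) i<n = m≤n⇒m⊔n≡n (incr Z i)

-- Unlike LocallyConstant _≡_, this also applies to maps into large types such as V* A.
LocallyConstant≡ : ∀ {b} {B : Set b} → (Inf → B) → Set b
LocallyConstant≡ f = ∀ Y → Σ ℕ λ n → ∀ Z → Extends Y n Z → f Z ≡ f Y

LocallyConstant≡-∘drop-min : ∀ {b} {B : Set b} {f : Inf → B} →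
  LocallyConstant≡ f → LocallyConstant≡ (f ∘ drop-min)
LocallyConstant≡-∘drop-min lc Y with lc (drop-min Y)
... | n , const = suc n , λ Z Z⊒Y → const (drop-min Z) (Extends-drop-min {Y} {Z} Z⊒Y)

LocallyConstant≡-zipWith : ∀ {b c d} {B : Set b} {C : Set c} {D : Set d}
  (_∙_ : B → C → D) {f : Inf → B} {g : Inf → C} →
  LocallyConstant≡ f → LocallyConstant≡ g → LocallyConstant≡ (λ Z → f Z ∙ g Z)
LocallyConstant≡-zipWith _∙_ lcf lcg Y with lcf Y | lcg Y
... | m , constf | n , constg = m ⊔ n , λ Z Z⊒Y → cong₂ _∙_
  (constf Z (Extends-≤ {Y} {Z} (m≤m⊔n m n) Z⊒Y))
  (constg Z (Extends-≤ {Y} {Z} (m≤n⊔m m n) Z⊒Y))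

LocallyConstant≡⇒LocallyConstant : {B : Set} {f : Inf → B} →
  LocallyConstant≡ f → LocallyConstant _≡_ f
LocallyConstant≡⇒LocallyConstant lc Y with lc Y
... | n , const = n , λ Z Z′ Z⊒Y Z′⊒Y → trans (const Z Z⊒Y) (sym (const Z′ Z′⊒Y))

module Canonical (em : ExcludedMiddle 0ℓ) {b} {B : Set b} (_~_ : B → B → Set)
  (h : Inf → B) (lc : LocallyConstant _~_ h) where

  ConstantOn : ℕ → Inf → Set
  ConstantOn n Y = ∀ Z Z′ → Extends Y n Z → Extends Y n Z′ → h Z ~ h Z′

  ConstantOn-transfer : ∀ {n Y Y′} → Extends Y n Y′ → ConstantOn n Y → ConstantOn n Y′
  ConstantOn-transfer {n} {Y} {Y′} Y′⊒Y const Z Z′ Z⊒Y′ Z′⊒Y′ =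
    const Z Z′ (Extends-trans {Y} {Y′} {W = Z} Y′⊒Y Z⊒Y′)
               (Extends-trans {Y} {Y′} {W = Z′} Y′⊒Y Z′⊒Y′)

  -- The test depends on Z only through its first n elements, as a list.
  constant? : Inf → ℕ → Bool
  constant? Z n = does (em {ConstantOn n (complete (prefix Z n))})

  bound : Inf → ℕ
  bound Z = proj₁ (lc Z)

  depth : Inf → ℕ
  depth Z = least (constant? Z) (bound Z)

  canonical : Inf → Inf
  canonical Z = complete (prefix Z (depth Z))

  h₀ : Inf → B
  h₀ = h ∘ canonical

  constant?-bound : ∀ Z → constant? Z (bound Z) ≡ true
  constant?-bound Z = dec-true em (ConstantOn-transfer {Y = Z} {Y′ = complete (prefix Z (bound Z))}
    (Extends-complete-prefix Z (bound Z)) (proj₂ (lc Z)))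

  ConstantOn-depth : ∀ Z → ConstantOn (depth Z) (canonical Z)
  ConstantOn-depth Z = does-true⇒ em (least-true (constant? Z) (bound Z) (constant?-bound Z))

  depth-cong : ∀ {Y Z} → Extends Y (depth Y) Z → depth Z ≡ depth Y
  depth-cong {Y} {Z} Z⊒Y = least-unique (constant? Z) (depth Y) (bound Z)
    (trans (agree ≤-refl) (least-true (constant? Y) (bound Y) (constant?-bound Y)))
    (λ m m<d → trans (agree (<⇒≤ m<d)) (least-minimal (constant? Y) (bound Y) m m<d))
    (constant?-bound Z)
    where
    agree : ∀ {m} → m ≤ depth Y → constant? Z m ≡ constant? Y m
    agree {m} m≤d = cong (λ l → does (em {ConstantOn m (complete l)}))
      (prefix-cong {Y} {Z} (Extends-≤ {Y} {Z} m≤d Z⊒Y))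

  Extends-canonical : ∀ Z → Extends (canonical Z) (depth Z) Z
  Extends-canonical Z = Extends-sym {Z} {canonical Z} (Extends-complete-prefix Z (depth Z))

  h₀-cong : ∀ {Y Z} → Extends Y (depth Y) Z → h₀ Z ≡ h₀ Y
  h₀-cong {Y} {Z} Z⊒Y =
    cong (h ∘ complete) (trans (cong (prefix Z) (depth-cong {Y} Z⊒Y)) (prefix-cong {Y} {Z} Z⊒Y))

  h₀-locallyConstant : LocallyConstant≡ h₀
  h₀-locallyConstant Y = depth Y , λ Z → h₀-cong

  h~h₀ : ∀ Z → h Z ~ h₀ Z
  h~h₀ Z = ConstantOn-depth Z Z (canonical Z) (Extends-canonical Z) (Extends-refl {canonical Z})

  h₀~h : ∀ Z → h₀ Z ~ h Z
  h₀~h Z = ConstantOn-depth Z (canonical Z) Z (Extends-refl {canonical Z}) (Extends-canonical Z)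

module _ {A : Set} {_≲_ : A → A → Set} (isPreorder : IsPreorder _≡_ _≲_) where

  private
    _⊑_ : V* A → V* A → Set
    _⊑_ = _≤*_ _≲_

  ≤*-trans : ∀ X Y Z → X ⊑ Y → Y ⊑ Z → X ⊑ Z
  ≤*-trans (ur p) (ur q) (ur r) p≤q q≤r = IsPreorder.trans isPreorder p≤q q≤r
  ≤*-trans (ur p) (ur q) (node K _ k) p≤q (l , q≤k) = l , ≤*-trans (ur p) (ur q) (k l) p≤q q≤k
  ≤*-trans (ur p) (node J _ g) (ur r) (j , p≤gj) g≤r = ≤*-trans (ur p) (g j) (ur r) p≤gj (g≤r j)
  ≤*-trans (ur p) (node J _ g) (node K _ k) (j , p≤gj) g≤k =
    let l , gj≤kl = g≤k j in l , ≤*-trans (ur p) (g j) (k l) p≤gj gj≤kl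
  ≤*-trans (node I _ f) (ur q) (ur r) f≤q q≤r i = ≤*-trans (f i) (ur q) (ur r) (f≤q i) q≤r
  ≤*-trans (node I _ f) (ur q) (node K _ k) f≤q (l , q≤k) i =
    l , ≤*-trans (f i) (ur q) (k l) (f≤q i) q≤k
  ≤*-trans (node I _ f) (node J _ g) (ur r) f≤g g≤r i =
    ≤*-trans (f i) (g (proj₁ (f≤g i))) (ur r) (proj₂ (f≤g i)) (g≤r (proj₁ (f≤g i)))
  ≤*-trans (node I _ f) (node J _ g) (node K _ k) f≤g g≤k i =
    let j , fi≤gj = f≤g i ; l , gj≤kl = g≤k j in
    l , ≤*-trans (f i) (g j) (k l) fi≤gj gj≤kl

  ≈*⇒≤* : ∀ X Y → X ≈* Y → X ⊑ Y
  ≈*⇒≤* (ur p) (ur q) p≡q = IsPreorder.reflexive isPreorder p≡q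
  ≈*⇒≤* (node I _ f) (node J _ g) (f⊆g , _) i =
    proj₁ (f⊆g i) , ≈*⇒≤* (f i) (g (proj₁ (f⊆g i))) (proj₂ (f⊆g i))

∈supp-resp-≈* : ∀ {A : Set} {q : A} X Y → q ∈supp X → X ≈* Y → q ∈supp Y
∈supp-resp-≈* (ur p) (ur p′) q≡p p≡p′ = trans q≡p p≡p′
∈supp-resp-≈* (node I _ f) (node J _ g) (i , q∈fi) (f⊆g , _) =
  proj₁ (f⊆g i) , ∈supp-resp-≈* (f i) (g (proj₁ (f⊆g i))) q∈fi (proj₂ (f⊆g i))

_↝_ : {A : Set} → V* A → V* A → Set₁
ur p ↝ y = y ≡ ur p
node I _ f ↝ y = Σ I λ i → y ≡ f i

↝-chain-reaches-ur : {A : Set} (x : ℕ → V* A) → (∀ k → x k ↝ x (suc k)) →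
  Σ ℕ λ k → Σ A λ p → x k ≡ ur p
↝-chain-reaches-ur x chain = reach (x 0) x refl chain
  where
  reach : ∀ {A} (T : V* A) (x : ℕ → V* A) → x 0 ≡ T → (∀ k → x k ↝ x (suc k)) →
    Σ ℕ λ k → Σ A λ p → x k ≡ ur p
  reach (ur p) x x₀≡p chain = 0 , p , x₀≡p
  reach (node I i₀ f) x x₀≡T chain with subst (_↝ x 1) x₀≡T (chain 0)
  ... | i , x₁≡fi with reach (f i) (x ∘ suc) x₁≡fi (chain ∘ suc)
  ... | k , p , xk≡p = suc k , p , xk≡p

module Step (em : ExcludedMiddle 0ℓ) {A : Set} (_≲_ : A → A → Set) where

  private
    _⊑_ : V* A → V* A → Set
    _⊑_ = _≤*_ _≲_

  -- The choice depends on P and i₀ alone, so step below is a function of its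
  -- arguments up to _≡_, which keeps its iterates locally constant.
  choose : {I : Set} → (I → Set) → I → I
  choose {I} P i₀ with em {Σ I P}
  ... | yes (i , _) = i
  ... | no _ = i₀

  choose-spec : {I : Set} (P : I → Set) (i₀ : I) → Σ I P → P (choose P i₀)
  choose-spec {I} P i₀ ∃P with em {Σ I P}
  ... | yes (_ , p) = p
  ... | no ¬∃P = ⊥-elim (¬∃P ∃P)

  ¬∀⇒∃¬ : {I : Set} {Q : I → Set} → ¬ (∀ i → Q i) → Σ I λ i → ¬ Q i
  ¬∀⇒∃¬ ¬∀Q = dne λ ¬∃¬Q → ¬∀Q λ i → dne λ ¬Qi → ¬∃¬Q (i , ¬Qi)
    where
    dne : {P : Set} → ¬ ¬ P → P
    dne = em⇒dne em

  Escapes : V* A → V* A → Set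
  Escapes x (ur q) = ¬ x ⊑ ur q
  Escapes x (node J _ g) = ∀ j → ¬ x ⊑ g j

  escapes-exists : ∀ {I} f y (i₀ : I) → ¬ node I i₀ f ⊑ y → Σ I λ i → Escapes (f i) y
  escapes-exists f (ur q) i₀ f≰q = ¬∀⇒∃¬ f≰q
  escapes-exists f (node J _ g) i₀ f≰g with ¬∀⇒∃¬ f≰g
  ... | i , fi≰g = i , λ j fi≤gj → fi≰g (j , fi≤gj)

  step : V* A → V* A → V* A
  step (ur p) y = ur p
  step (node I i₀ f) y = f (choose (λ i → Escapes (f i) y) i₀)

  escapes-step : ∀ x y z → Escapes x y → ¬ x ⊑ step y z
  escapes-step x (ur q) z x≰q = x≰q
  escapes-step x (node J j₀ g) z x≰g = x≰g _

  step-bad : ∀ x y z → ¬ x ⊑ y → ¬ step x y ⊑ step y z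
  step-bad (ur p) (ur q) z p≰q = p≰q
  step-bad (ur p) (node J j₀ g) z p≰g p≤gj = p≰g (_ , p≤gj)
  step-bad (node I i₀ f) y z f≰y = escapes-step _ y z
    (choose-spec (λ i → Escapes (f i) y) i₀ (escapes-exists f y i₀ f≰y))

  step-supp : ∀ {q} x y → q ∈supp step x y → q ∈supp x
  step-supp (ur p) y q≡p = q≡p
  step-supp (node I i₀ f) y q∈ = _ , q∈

  step-↝ : ∀ x y → x ↝ step x y
  step-↝ (ur p) y = refl
  step-↝ (node I i₀ f) y = _ , refl

module Proof (em : ExcludedMiddle (lsuc 0ℓ)) {A : Set} {_≲_ : A → A → Set}
  (isPreorder : IsPreorder _≡_ _≲_) (h : Inf → V* A)
  (bad : Bad (_≤*_ _≲_) h) (lc : LocallyConstant _≈*_ h) where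

  private
    _⊑_ : V* A → V* A → Set
    _⊑_ = _≤*_ _≲_
    em₀ : ExcludedMiddle 0ℓ
    em₀ = lower-em em

  open Canonical em₀ _≈*_ h lc using (h₀; h₀-locallyConstant; h~h₀; h₀~h)
  open Step em₀ _≲_ using (step; step-bad; step-supp; step-↝)

  stepMap : (Inf → V* A) → Inf → V* A
  stepMap f Z = step (f Z) (f (drop-min Z))

  descent : ℕ → Inf → V* A
  descent zero = h₀
  descent (suc k) = stepMap (descent k)

  h₀-bad : Bad _⊑_ h₀
  h₀-bad N h₀N≤h₀N′ = bad N (≤*-trans isPreorder (h N) _ _ (≈*⇒≤* isPreorder _ _ (h~h₀ N))
    (≤*-trans isPreorder (h₀ N) _ _ h₀N≤h₀N′ (≈*⇒≤* isPreorder _ _ (h₀~h (drop-min N)))))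

  descent-bad : ∀ k → Bad _⊑_ (descent k)
  descent-bad zero = h₀-bad
  descent-bad (suc k) N =
    step-bad (descent k N) (descent k (drop-min N)) (descent k (drop-min (drop-min N)))
      (descent-bad k N)

  descent-locallyConstant : ∀ k → LocallyConstant≡ (descent k)
  descent-locallyConstant zero = h₀-locallyConstant
  descent-locallyConstant (suc k) = LocallyConstant≡-zipWith step
    (descent-locallyConstant k) (LocallyConstant≡-∘drop-min {f = descent k} (descent-locallyConstant k))

  descent-supp : ∀ k {Z q} → q ∈supp descent k Z → q ∈supp h₀ Z
  descent-supp zero q∈ = q∈
  descent-supp (suc k) q∈ = descent-supp k (step-supp _ _ q∈)

  descent-settles : ∀ Z → Σ ℕ λ k → Σ A λ p → descent k Z ≡ ur p
  descent-settles Z = ↝-chain-reaches-ur (λ k → descent k Z) (λ k → step-↝ _ _)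

  descent-stays : ∀ {k k′ Z p} → k ≤′ k′ → descent k Z ≡ ur p → descent k′ Z ≡ ur p
  descent-stays (≤′-reflexive refl) settled = settled
  descent-stays {k′ = suc k′} {Z} (≤′-step k≤k′) settled =
    cong (λ x → step x (descent k′ (drop-min Z))) (descent-stays k≤k′ settled)

  settling-time : Inf → ℕ
  settling-time Z = proj₁ (descent-settles Z)

  g : Inf → A
  g Z = proj₁ (proj₂ (descent-settles Z))

  descent-settled : ∀ {k} Z → settling-time Z ≤ k → descent k Z ≡ ur (g Z)
  descent-settled Z t≤k = descent-stays (≤⇒≤′ t≤k) (proj₂ (proj₂ (descent-settles Z)))

  g-unique : ∀ {k Z p} → descent k Z ≡ ur p → g Z ≡ p
  g-unique {k} {Z} settled = ur-injective (trans
    (sym (descent-settled Z (m≤n⊔m k t))) (descent-stays (≤⇒≤′ (m≤m⊔n k t)) settled))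
    where
    t : ℕ
    t = settling-time Z
    ur-injective : ∀ {p q : A} → ur p ≡ ur q → p ≡ q
    ur-injective refl = refl

  g-bad : Bad _≲_ g
  g-bad M gM≤gM′ = descent-bad (t ⊔ t′) M (subst₂ _⊑_
    (sym (descent-settled M (m≤m⊔n t t′)))
    (sym (descent-settled (drop-min M) (m≤n⊔m t t′)))
    gM≤gM′)
    where
    t t′ : ℕ
    t = settling-time M
    t′ = settling-time (drop-min M)

  g-locallyConstant : LocallyConstant≡ g
  g-locallyConstant Y with descent-locallyConstant (settling-time Y) Y
  ... | n , const = n , λ Z Z⊒Y →
    g-unique {settling-time Y} (trans (const Z Z⊒Y) (descent-settled Y ≤-refl))

  g-supp : ∀ X → g X ∈supp h X
  g-supp X = ∈supp-resp-≈* (h₀ X) (h X)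
    (descent-supp (settling-time X) (subst (g X ∈supp_) (sym (descent-settled X ≤-refl)) refl))
    (h₀~h X)

proposition3p42 : ExcludedMiddle (lsuc 0ℓ) →
    (A : Set) (_≲_ : A → A → Set) → IsPreorder _≡_ _≲_ →
    (h : Inf → V* A) →
    Bad (_≤*_ _≲_) h → LocallyConstant _≈*_ h →
    Σ (Inf → A) λ g →
    Bad _≲_ g × LocallyConstant _≡_ g × (∀ X → g X ∈supp h X)
proposition3p42 em A _≲_ isPreorder h bad lc =
  g , g-bad , LocallyConstant≡⇒LocallyConstant g-locallyConstant , g-supp
  where open Proof em isPreorder h bad lc
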